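{- Let $n,k,t$ be positive integers with $k,t\le n$. Then \[\left[{n\atop k/t}\right]=\left[{n-1\atop k/t-1}\right]+(k-1)\left[{n-1\atop k-1/t}\right]+(n-1)\left[{n-1\atop k/t}\right].\]
   Context: For integers $m\ge0$, $k\ge1$, $t\ge0$, a mixed coloured permutation of $[m]=\{1,\ldots,m\}$ is a permutation of $[m]$ together with a colouring of its cycles with colours from $\{1,\ldots,k\}$ such that exactly $t$ cycles receive colour $1$ (the special colour) and each of the colours $2,\ldots,k$ is used on exactly one cycle; $\left[{m\atop k/t}\right]$ denotes their number. A term multiplied by the coefficient $k-1=0$ is interpreted as $0$. -}

module Defs where

open import Data.Nat using (ℕ; zero; suc; _+_; _*_; _∸_; _≤ᵇ_)
open import Data.Bool using (Bool; true; false; _∧_; _∨_; not; if_then_else_)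
open import Data.Fin using (Fin; toℕ)
open import Data.Fin.Properties using () renaming (_≟_ to _≟F_)
open import Data.Nat.Properties using () renaming (_≟_ to _≟N_)
open import Data.List using (List; []; _∷_; map; concatMap; length; allFin; upTo)
open import Data.Vec using (Vec; []; _∷_; lookup)
open import Relation.Nullary.Decidable using (⌊_⌋)

allL : {A : Set} → (A → Bool) → List A → Bool
allL p [] = true
allL p (x ∷ xs) = p x ∧ allL p xs

anyL : {A : Set} → (A → Bool) → List A → Bool
anyL p [] = false
anyL p (x ∷ xs) = p x ∨ anyL p xs

countL : {A : Set} → (A → Bool) → List A → ℕ
countL p [] = zero
countL p (x ∷ xs) = if p x then suc (countL p xs) else countL p xs

sumL : {A : Set} → (A → ℕ) → List A → ℕ
sumL f [] = zero
sumL f (x ∷ xs) = f x + sumL f xs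

allVecs : {A : Set} → List A → (n : ℕ) → List (Vec A n)
allVecs xs zero = [] ∷ []
allVecs xs (suc n) = concatMap (λ x → map (x ∷_) (allVecs xs n)) xs

_==F_ : {m : ℕ} → Fin m → Fin m → Bool
i ==F j = ⌊ i ≟F j ⌋

-- A map [m] → [m] is encoded by the vector of its values σ(1),…,σ(m).
Map : ℕ → Set
Map m = Vec (Fin m) m

isPerm : {m : ℕ} → Map m → Bool
isPerm {m} σ = allL (λ i → allL (λ j → not (lookup σ i ==F lookup σ j) ∨ (i ==F j)) (allFin m)) (allFin m)

iter : {m : ℕ} → Map m → ℕ → Fin m → Fin m
iter σ zero i = i
iter σ (suc r) i = lookup σ (iter σ r i)

sameCycle : {m : ℕ} → Map m → Fin m → Fin m → Bool
sameCycle {m} σ i j = anyL (λ r → iter σ r i ==F j) (upTo (suc m))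

isRep : {m : ℕ} → Map m → Fin m → Bool
isRep {m} σ i = allL (λ j → not (sameCycle σ i j) ∨ (toℕ i ≤ᵇ toℕ j)) (allFin m)

-- A colouring of the cycles of σ is encoded as a colouring c of the points
-- that is constant on each cycle (c ∘ σ = c); colour "1" is Fin.zero.
constOnCycles : {m k : ℕ} → Map m → Vec (Fin k) m → Bool
constOnCycles {m} σ c = allL (λ i → lookup c (lookup σ i) ==F lookup c i) (allFin m)

cyclesWithColour : {m k : ℕ} → Map m → Vec (Fin k) m → Fin k → ℕ
cyclesWithColour {m} σ c a = countL (λ i → isRep σ i ∧ (lookup c i ==F a)) (allFin m)

isSpecial : {k : ℕ} → Fin k → Bool
isSpecial a = ⌊ toℕ a ≟N 0 ⌋

isMixedColoured : {m k : ℕ} → ℕ → Map m → Vec (Fin k) m → Bool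
isMixedColoured {m} {k} t σ c =
  isPerm σ ∧ constOnCycles σ c
  ∧ allL (λ a → if isSpecial a
                  then ⌊ cyclesWithColour σ c a ≟N t ⌋
                  else ⌊ cyclesWithColour σ c a ≟N 1 ⌋) (allFin k)

mixedColoured : ℕ → ℕ → ℕ → ℕ
mixedColoured m k t =
  sumL (λ σ → countL (λ c → isMixedColoured t σ c) (allVecs (allFin k) m)) (allVecs (allFin m) m)

module Submission where

-- Classify a mixed coloured permutation of [n] by what happens to the largest
-- point n :
--   (1) n is a fixed point of the special colour 1: deleting it leaves a mixed
--       coloured permutation of [n-1] with t-1 special cycles;
--   (2) n is a fixed point of a non-special colour  j+1 : that colour is used on no
--       other cycle, so deleting n and renaming the colours leaves a pair
--       (j , mixed coloured permutation of [n-1] with k-1 colours);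
--   (3) n lies on a longer cycle, before its successor s : cutting n out of the
--       cycle leaves a pair (s , mixed coloured permutation of [n-1]).
-- Each class is counted by an explicit bijection.

open import Defs
open import Data.Nat using (ℕ; zero; suc; _+_; _*_; _∸_; _≤_; _<_; z≤n; s≤s; _≤ᵇ_)
open import Data.Nat.Properties
  using (+-comm; +-suc; +-commutativeSemigroup; +-identityʳ; +-cancelʳ-≡; suc-injective; ≤-refl; ≤-trans; ≤-pred; <⇒≤; <-irrefl;
         m∸n+n≡m; m≤n⇒m<n∨m≡n; +-monoʳ-<; ≤ᵇ⇒≤; ≤⇒≤ᵇ)
  renaming (_≟_ to _≟N_)
open import Algebra.Properties.CommutativeSemigroup +-commutativeSemigroup
  using () renaming (interchange to +-interchange)
open import Data.Bool using (Bool; true; false; _∧_; _∨_; not; if_then_else_; T)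
open import Data.Bool.Properties using (∧-assoc; ∧-identityʳ; ∧-zeroʳ; ∨-zeroʳ; T-≡)
open import Data.Fin using (Fin; toℕ; inject₁; fromℕ; punchIn; pinch; lower₁) renaming (zero to fz; suc to fs)
open import Data.Fin.Properties
  using (fromℕ≢inject₁; inject₁-injective; toℕ-injective; toℕ-inject₁; toℕ-fromℕ; toℕ<n; pigeonhole;
         punchIn-injective; punchInᵢ≢i; punchIn-punchOut; inject₁-lower₁; inject₁≡⇒lower₁≡)
  renaming (_≟_ to _≟F_)
open import Data.List using (List; []; _∷_; map; concatMap; _++_; length; allFin; tabulate; applyUpTo)
import Data.List.Properties as List
open import Data.Vec using (Vec; []; _∷_; lookup; _∷ʳ_; init; last; initLast)
import Data.Vec.Properties as Vec
open import Data.Product using (_×_; _,_; proj₁; proj₂; ∃)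
import Data.Product.Properties as Product
open import Data.Sum using (_⊎_; inj₁; inj₂)
open import Data.Empty using (⊥; ⊥-elim)
open import Relation.Nullary using (Dec; yes; no; ¬_; does)
open import Relation.Nullary.Decidable using (⌊_⌋; dec-true; dec-false)
open import Relation.Binary.PropositionalEquality
open import Relation.Binary.Definitions using (DecidableEquality)
open import Function using (_∘_; id)
open import Function.Bundles using (Equivalence)

bool-ext : ∀ {a b : Bool} → (a ≡ true → b ≡ true) → (b ≡ true → a ≡ true) → a ≡ b
bool-ext {true}  {true}  f g = refl
bool-ext {true}  {false} f g = sym (f refl)
bool-ext {false} {true}  f g = g refl
bool-ext {false} {false} f g = refl

not-true⇒false : ∀ {b : Bool} → ¬ b ≡ true → b ≡ false
not-true⇒false {true}  h = ⊥-elim (h refl)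
not-true⇒false {false} h = refl

true≢false : true ≢ false
true≢false ()

∧-true₁ : ∀ {a b} → a ∧ b ≡ true → a ≡ true
∧-true₁ {true} e = refl

∧-true₂ : ∀ {a b} → a ∧ b ≡ true → b ≡ true
∧-true₂ {true} e = e

∧-intro : ∀ {a b} → a ≡ true → b ≡ true → a ∧ b ≡ true
∧-intro refl refl = refl

not≡true⇒false : ∀ {b} → not b ≡ true → b ≡ false
not≡true⇒false {false} _ = refl

∧-true-true : ∀ b → (b ∧ true) ∧ true ≡ b
∧-true-true b rewrite ∧-identityʳ b = ∧-identityʳ b

isYes⇒ : ∀ {P : Set} (d : Dec P) → ⌊ d ⌋ ≡ true → P
isYes⇒ (yes p) _ = p

isYes⇐ : ∀ {P : Set} (d : Dec P) → P → ⌊ d ⌋ ≡ true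
isYes⇐ (yes _) _ = refl
isYes⇐ (no ¬p) p = ⊥-elim (¬p p)

isYes-no : ∀ {P : Set} (d : Dec P) → ¬ P → ⌊ d ⌋ ≡ false
isYes-no (yes p) ¬p = ⊥-elim (¬p p)
isYes-no (no _)  _  = refl

T⇒≡true : ∀ {b} → T b → b ≡ true
T⇒≡true = Equivalence.to T-≡

≡true⇒T : ∀ {b} → b ≡ true → T b
≡true⇒T = Equivalence.from T-≡

==F-sound : ∀ {m} (i j : Fin m) → (i ==F j) ≡ true → i ≡ j
==F-sound i j = isYes⇒ (i ≟F j)

==F-refl : ∀ {m} (i : Fin m) → (i ==F i) ≡ true
==F-refl i = isYes⇐ (i ≟F i) refl

==F-false : ∀ {m} (i j : Fin m) → i ≢ j → (i ==F j) ≡ false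
==F-false i j = isYes-no (i ≟F j)

≡⇒==F : ∀ {m} {i j : Fin m} → i ≡ j → (i ==F j) ≡ true
≡⇒==F refl = ==F-refl _

indicator : Bool → ℕ
indicator true  = 1
indicator false = 0

countL-as-sum : ∀ {A : Set} (p : A → Bool) xs → countL p xs ≡ sumL (indicator ∘ p) xs
countL-as-sum p [] = refl
countL-as-sum p (x ∷ xs) with p x
... | true  = cong suc (countL-as-sum p xs)
... | false = countL-as-sum p xs

sumL-cong : ∀ {A : Set} {f g : A → ℕ} xs → (∀ x → f x ≡ g x) → sumL f xs ≡ sumL g xs
sumL-cong []       e = refl
sumL-cong (x ∷ xs) e = cong₂ _+_ (e x) (sumL-cong xs e)

countL-cong : ∀ {A : Set} {p q : A → Bool} xs → (∀ x → p x ≡ q x) → countL p xs ≡ countL q xs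
countL-cong []       e = refl
countL-cong (x ∷ xs) e rewrite e x | countL-cong xs e = refl

allL-cong : ∀ {A : Set} {p q : A → Bool} xs → (∀ x → p x ≡ q x) → allL p xs ≡ allL q xs
allL-cong []       e = refl
allL-cong (x ∷ xs) e = cong₂ _∧_ (e x) (allL-cong xs e)

sumL-zero : ∀ {A : Set} xs → sumL {A} (λ _ → 0) xs ≡ 0
sumL-zero []       = refl
sumL-zero (x ∷ xs) = sumL-zero xs

countL-none : ∀ {A : Set} xs → countL {A} (λ _ → false) xs ≡ 0
countL-none []       = refl
countL-none (x ∷ xs) = countL-none xs

sumL-+ : ∀ {A : Set} (f g : A → ℕ) xs → sumL (λ x → f x + g x) xs ≡ sumL f xs + sumL g xs
sumL-+ f g [] = refl
sumL-+ f g (x ∷ xs) = begin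
  f x + g x + sumL (λ x → f x + g x) xs  ≡⟨ cong (f x + g x +_) (sumL-+ f g xs) ⟩
  f x + g x + (sumL f xs + sumL g xs)    ≡⟨ +-interchange (f x) (g x) (sumL f xs) (sumL g xs) ⟩
  f x + sumL f xs + (g x + sumL g xs)    ∎
  where open ≡-Reasoning

sumL-swap : ∀ {A B : Set} (F : A → B → ℕ) xs ys →
  sumL (λ x → sumL (F x) ys) xs ≡ sumL (λ y → sumL (λ x → F x y) xs) ys
sumL-swap F []       ys = sym (sumL-zero ys)
sumL-swap F (x ∷ xs) ys = trans (cong (sumL (F x) ys +_) (sumL-swap F xs ys))
  (sym (sumL-+ (F x) (λ y → sumL (λ x → F x y) xs) ys))

countL-++ : ∀ {A : Set} (p : A → Bool) xs ys → countL p (xs ++ ys) ≡ countL p xs + countL p ys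
countL-++ p []       ys = refl
countL-++ p (x ∷ xs) ys with p x
... | true  = cong suc (countL-++ p xs ys)
... | false = countL-++ p xs ys

countL-concatMap : ∀ {A B : Set} (p : B → Bool) (f : A → List B) xs →
  countL p (concatMap f xs) ≡ sumL (λ x → countL p (f x)) xs
countL-concatMap p f []       = refl
countL-concatMap p f (x ∷ xs) = trans (countL-++ p (f x) _) (cong (countL p (f x) +_) (countL-concatMap p f xs))

countL-map : ∀ {A B : Set} (p : B → Bool) (f : A → B) xs → countL p (map f xs) ≡ countL (p ∘ f) xs
countL-map p f []       = refl
countL-map p f (x ∷ xs) with p (f x)
... | true  = cong suc (countL-map p f xs)
... | false = countL-map p f xs

countL-guarded : ∀ {A : Set} (b : Bool) (p : A → Bool) xs → countL (λ x → b ∧ p x) xs ≡ (if b then countL p xs else 0)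
countL-guarded true  p xs = refl
countL-guarded false p xs = countL-none xs

countL-split : ∀ {A : Set} (p q : A → Bool) xs →
  countL p xs ≡ countL (λ x → p x ∧ q x) xs + countL (λ x → p x ∧ not (q x)) xs
countL-split p q [] = refl
countL-split p q (x ∷ xs) with p x | q x
... | true  | true  = cong suc (countL-split p q xs)
... | true  | false = trans (cong suc (countL-split p q xs)) (sym (+-suc _ _))
... | false | _     = countL-split p q xs

record Enum (A : Set) : Set where
  field
    dec   : DecidableEquality A
    list  : List A
    exact : ∀ x → countL (λ y → does (dec y x)) list ≡ 1
open Enum public

-- Then both counts agree: they both equal the double sum of
-- [R y ∧ x = g y]  over A × B.
module _ {A B : Set} (EA : Enum A) (EB : Enum B) (Q : A → Bool) (R : B → Bool)
  (f : ∀ x → Q x ≡ true → B) (g : B → A) (Qg≡R : ∀ y → Q (g y) ≡ R y)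
  (gf : ∀ x q → g (f x q) ≡ x) (fg : ∀ y → R y ≡ true → ∀ q → f (g y) q ≡ y) where

  private
    fR : ∀ x q → R (f x q) ≡ true
    fR x q = trans (sym (Qg≡R (f x q))) (subst (λ z → Q z ≡ true) (sym (gf x q)) q)

    gQ : ∀ y → R y ≡ true → Q (g y) ≡ true
    gQ y r = trans (Qg≡R y) r

    incidence : A → B → ℕ
    incidence x y = indicator (R y ∧ does (dec EA x (g y)))

    f-irrelevant : ∀ {x z} (q : Q x ≡ true) (p : x ≡ z) → f z (subst (λ z → Q z ≡ true) p q) ≡ f x q
    f-irrelevant q refl = refl

    -- For fixed x, the incidences are exactly the y with y = f x.
    row : ∀ x → sumL (incidence x) (list EB) ≡ indicator (Q x)
    row x with Q x in Qx
    ... | true = trans (sym (countL-as-sum _ (list EB))) (trans (countL-cong (list EB) at) (exact EB (f x Qx)))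
      where
      at : ∀ y → R y ∧ does (dec EA x (g y)) ≡ does (dec EB y (f x Qx))
      at y with R y in Ry | dec EA x (g y)
      ... | true  | yes x≡gy = sym (dec-true (dec EB y (f x Qx))
                                   (trans (sym (fg y Ry (subst (λ z → Q z ≡ true) x≡gy Qx))) (f-irrelevant Qx x≡gy)))
      ... | true  | no x≢gy = sym (dec-false (dec EB y (f x Qx)) λ { refl → x≢gy (sym (gf x Qx)) })
      ... | false | _       = sym (dec-false (dec EB y (f x Qx)) λ { refl → true≢false (trans (sym (fR x Qx)) Ry) })
    ... | false = trans (sumL-cong (list EB) at) (sumL-zero (list EB))
      where
      at : ∀ y → incidence x y ≡ 0
      at y with R y in Ry | dec EA x (g y)
      ... | true  | yes refl = ⊥-elim (true≢false (trans (sym (gQ y Ry)) Qx))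
      ... | true  | no _     = refl
      ... | false | _        = refl

    -- For fixed y, the only incidence is x = g y (when R y).
    column : ∀ y → sumL (λ x → incidence x y) (list EA) ≡ indicator (R y)
    column y with R y
    ... | true  = trans (sym (countL-as-sum _ (list EA))) (exact EA (g y))
    ... | false = sumL-zero (list EA)

  bijective-count : countL Q (list EA) ≡ countL R (list EB)
  bijective-count = begin
    countL Q (list EA)                                    ≡⟨ countL-as-sum Q (list EA) ⟩
    sumL (indicator ∘ Q) (list EA)                        ≡⟨ sumL-cong (list EA) (sym ∘ row) ⟩
    sumL (λ x → sumL (incidence x) (list EB)) (list EA)   ≡⟨ sumL-swap incidence (list EA) (list EB) ⟩
    sumL (λ y → sumL (λ x → incidence x y) (list EA)) (list EB) ≡⟨ sumL-cong (list EB) column ⟩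
    sumL (indicator ∘ R) (list EB)                        ≡⟨ countL-as-sum R (list EB) ⟨
    countL R (list EB)                                    ∎
    where open ≡-Reasoning

countL-grid : ∀ {A B C : Set} (dA : DecidableEquality A) (dB : DecidableEquality B) (dC : DecidableEquality C)
  (h : A → B → C) (h-inj : ∀ {a b a' b'} → h a b ≡ h a' b' → (a ≡ a') × (b ≡ b')) LA LB →
  (∀ x → countL (λ y → does (dA y x)) LA ≡ 1) → (∀ x → countL (λ y → does (dB y x)) LB ≡ 1) →
  ∀ a₀ b₀ → countL (λ z → does (dC z (h a₀ b₀))) (concatMap (λ a → map (h a) LB) LA) ≡ 1
countL-grid dA dB dC h h-inj LA LB exactA exactB a₀ b₀ = begin
  countL (λ z → does (dC z (h a₀ b₀))) (concatMap (λ a → map (h a) LB) LA)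
    ≡⟨ countL-concatMap _ (λ a → map (h a) LB) LA ⟩
  sumL (λ a → countL (λ z → does (dC z (h a₀ b₀))) (map (h a) LB)) LA
    ≡⟨ sumL-cong LA row ⟩
  sumL (λ a → indicator (does (dA a a₀))) LA
    ≡⟨ countL-as-sum _ LA ⟨
  countL (λ a → does (dA a a₀)) LA
    ≡⟨ exactA a₀ ⟩
  1 ∎
  where
  open ≡-Reasoning
  split : ∀ a b → does (dC (h a b) (h a₀ b₀)) ≡ does (dA a a₀) ∧ does (dB b b₀)
  split a b with dA a a₀ | dB b b₀
  ... | yes refl | yes refl = dec-true (dC (h a b) (h a b)) refl
  ... | yes _    | no b≢b₀  = dec-false (dC _ _) (b≢b₀ ∘ proj₂ ∘ h-inj)
  ... | no a≢a₀  | _        = dec-false (dC _ _) (a≢a₀ ∘ proj₁ ∘ h-inj)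
  row : ∀ a → countL (λ z → does (dC z (h a₀ b₀))) (map (h a) LB) ≡ indicator (does (dA a a₀))
  row a rewrite countL-map (λ z → does (dC z (h a₀ b₀))) (h a) LB
              | countL-cong {p = λ b → does (dC (h a b) (h a₀ b₀))} LB (split a)
              | countL-guarded (does (dA a a₀)) (λ b → does (dB b b₀)) LB
              with does (dA a a₀)
  ... | true  = exactB b₀
  ... | false = refl

pairs : ∀ {A B : Set} → List A → List B → List (A × B)
pairs LA LB = concatMap (λ a → map (a ,_) LB) LA

EnumPair : ∀ {A B : Set} → Enum A → Enum B → Enum (A × B)
EnumPair EA EB = record
  { dec   = Product.≡-dec (dec EA) (dec EB)
  ; list  = pairs (list EA) (list EB)
  ; exact = λ (a , b) → countL-grid (dec EA) (dec EB) (Product.≡-dec (dec EA) (dec EB)) _,_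
              (λ { refl → refl , refl }) (list EA) (list EB) (exact EA) (exact EB) a b
  }

EnumVec : ∀ {A : Set} → Enum A → ∀ n → Enum (Vec A n)
EnumVec EA n = record { dec = Vec.≡-dec (dec EA) ; list = allVecs (list EA) n ; exact = exactVec n }
  where
  exactVec : ∀ n (v : Vec _ n) → countL (λ w → does (Vec.≡-dec (dec EA) w v)) (allVecs (list EA) n) ≡ 1
  exactVec zero    []      = refl
  exactVec (suc n) (a ∷ v) = countL-grid (dec EA) (Vec.≡-dec (dec EA)) (Vec.≡-dec (dec EA)) _∷_ Vec.∷-injective
    (list EA) (allVecs (list EA) n) (exact EA) (exactVec n) a v

countL-tabulate : ∀ {A B : Set} {n} (p : A → Bool) (q : B → Bool) (g : Fin n → A) (h : Fin n → B) →
  (∀ i → p (g i) ≡ q (h i)) → countL p (tabulate g) ≡ countL q (tabulate h)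
countL-tabulate {n = zero}  p q g h e = refl
countL-tabulate {n = suc n} p q g h e rewrite e fz | countL-tabulate p q (g ∘ fs) (h ∘ fs) (e ∘ fs) = refl

EnumFin : ∀ n → Enum (Fin n)
EnumFin n = record { dec = _≟F_ ; list = allFin n ; exact = exactFin n }
  where
  exactFin : ∀ n (x : Fin n) → countL (λ y → does (y ≟F x)) (allFin n) ≡ 1
  exactFin (suc n) fz     = cong suc (trans (countL-tabulate {n = n} (λ y → does (y ≟F fz)) (λ _ → false) fs id (λ _ → refl)) (countL-none (allFin n)))
  exactFin (suc n) (fs x) = trans (countL-tabulate _ (λ y → does (y ≟F x)) fs id (λ _ → refl)) (exactFin n x)

countL-pairs-snd : ∀ {A B : Set} (R : B → Bool) (LA : List A) LB →
  countL (R ∘ proj₂) (pairs LA LB) ≡ length LA * countL R LB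
countL-pairs-snd R []       LB = refl
countL-pairs-snd R (a ∷ LA) LB = trans (countL-++ _ (map (a ,_) LB) _) (cong₂ _+_ (countL-map _ (a ,_) LB) (countL-pairs-snd R LA LB))

allL-tabulate⇒ : ∀ {A : Set} {n} (p : A → Bool) (g : Fin n → A) → allL p (tabulate g) ≡ true → ∀ i → p (g i) ≡ true
allL-tabulate⇒ p g e fz     = ∧-true₁ e
allL-tabulate⇒ p g e (fs i) = allL-tabulate⇒ p (g ∘ fs) (∧-true₂ {p (g fz)} e) i

allL-tabulate⇐ : ∀ {A : Set} {n} (p : A → Bool) (g : Fin n → A) → (∀ i → p (g i) ≡ true) → allL p (tabulate g) ≡ true
allL-tabulate⇐ {n = zero}  p g h = refl
allL-tabulate⇐ {n = suc n} p g h = ∧-intro (h fz) (allL-tabulate⇐ p (g ∘ fs) (h ∘ fs))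

allL-tabulate : ∀ {A B : Set} {n} (p : A → Bool) (q : B → Bool) (g : Fin n → A) (h : Fin n → B) →
  (∀ i → p (g i) ≡ q (h i)) → allL p (tabulate g) ≡ allL q (tabulate h)
allL-tabulate {n = zero}  p q g h e = refl
allL-tabulate {n = suc n} p q g h e = cong₂ _∧_ (e fz) (allL-tabulate p q (g ∘ fs) (h ∘ fs) (e ∘ fs))

allL-last : ∀ {A : Set} {m} (p : A → Bool) (g : Fin (suc m) → A) →
  allL p (tabulate g) ≡ allL p (tabulate (g ∘ inject₁)) ∧ p (g (fromℕ m))
allL-last {m = zero}  p g = ∧-identityʳ (p (g fz))
allL-last {m = suc m} p g = trans (cong (p (g fz) ∧_) (allL-last p (g ∘ fs))) (sym (∧-assoc (p (g fz)) _ _))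

countL-last : ∀ {A : Set} {m} (p : A → Bool) (g : Fin (suc m) → A) →
  countL p (tabulate g) ≡ countL p (tabulate (g ∘ inject₁)) + indicator (p (g (fromℕ m)))
countL-last {m = zero} p g with p (g fz)
... | true  = refl
... | false = refl
countL-last {m = suc m} p g with p (g fz)
... | true  = cong suc (countL-last p (g ∘ fs))
... | false = countL-last p (g ∘ fs)

countL-zero : ∀ {A : Set} {n} (p : A → Bool) (g : Fin n → A) → countL p (tabulate g) ≡ 0 → ∀ i → p (g i) ≡ false
countL-zero {n = suc n} p g e i with p (g fz) in pz
countL-zero {n = suc n} p g () i      | true
countL-zero {n = suc n} p g e fz     | false = pz
countL-zero {n = suc n} p g e (fs i) | false = countL-zero p (g ∘ fs) e i

anyL-applyUpTo⇒ : ∀ {A : Set} (p : A → Bool) (f : ℕ → A) n → anyL p (applyUpTo f n) ≡ true → ∃ λ r → r < n × p (f r) ≡ true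
anyL-applyUpTo⇒ p f (suc n) e with p (f 0) in p0
... | true  = 0 , s≤s z≤n , p0
... | false with anyL-applyUpTo⇒ p (f ∘ suc) n e
... | r , r<n , pr = suc r , s≤s r<n , pr

anyL-applyUpTo⇐ : ∀ {A : Set} (p : A → Bool) (f : ℕ → A) n r → r < n → p (f r) ≡ true → anyL p (applyUpTo f n) ≡ true
anyL-applyUpTo⇐ p f (suc n) zero    r<n pr rewrite pr = refl
anyL-applyUpTo⇐ p f (suc n) (suc r) (s≤s r<n) pr with p (f 0)
... | true  = refl
... | false = anyL-applyUpTo⇐ p (f ∘ suc) n r r<n pr

data FinView {m : ℕ} : Fin (suc m) → Set where
  old : (j : Fin m) → FinView (inject₁ j)
  new : FinView (fromℕ m)

finView : ∀ {m} (x : Fin (suc m)) → FinView x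
finView {zero}  fz     = new
finView {suc m} fz     = old fz
finView {suc m} (fs x) with finView x
... | old j = old (fs j)
... | new   = new

old≢new : ∀ {m} (j : Fin m) → inject₁ j ≢ fromℕ m
old≢new j e = fromℕ≢inject₁ (sym e)

old-or-new : ∀ {m} (x : Fin (suc m)) → (∃ λ u → x ≡ inject₁ u) ⊎ x ≡ fromℕ m
old-or-new x with finView x
... | old u = inj₁ (u , refl)
... | new   = inj₂ refl

init-∷ʳ-last : ∀ {A : Set} {m} (v : Vec A (suc m)) → init v ∷ʳ last v ≡ v
init-∷ʳ-last v = sym (proj₂ (proj₂ (initLast v)))

lookup-∷ʳ-old : ∀ {A : Set} {m} (v : Vec A m) a j → lookup (v ∷ʳ a) (inject₁ j) ≡ lookup v j
lookup-∷ʳ-old (x ∷ v) a fz     = refl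
lookup-∷ʳ-old (x ∷ v) a (fs j) = lookup-∷ʳ-old v a j

lookup-∷ʳ-new : ∀ {A : Set} {m} (v : Vec A m) a → lookup (v ∷ʳ a) (fromℕ m) ≡ a
lookup-∷ʳ-new []      a = refl
lookup-∷ʳ-new (x ∷ v) a = lookup-∷ʳ-new v a

lookup-init : ∀ {A : Set} {m} (v : Vec A (suc m)) j → lookup (init v) j ≡ lookup v (inject₁ j)
lookup-init v j = trans (sym (lookup-∷ʳ-old (init v) (last v) j)) (cong (λ w → lookup w (inject₁ j)) (init-∷ʳ-last v))

last≡lookup-new : ∀ {A : Set} {m} (v : Vec A (suc m)) → last v ≡ lookup v (fromℕ m)
last≡lookup-new v = trans (sym (lookup-∷ʳ-new (init v) (last v))) (cong (λ w → lookup w (fromℕ _)) (init-∷ʳ-last v))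

vec-ext : ∀ {A : Set} {m} (v w : Vec A m) → (∀ i → lookup v i ≡ lookup w i) → v ≡ w
vec-ext []      []      e = refl
vec-ext (x ∷ v) (y ∷ w) e = cong₂ _∷_ (e fz) (vec-ext v w (e ∘ fs))

-- Forgetting the new point: a left inverse of  inject₁  (the new point goes to some old point).

squash : ∀ {m} → Fin (suc (suc m)) → Fin (suc m)
squash fz              = fz
squash {zero}  (fs x) = fz
squash {suc m} (fs x) = fs (squash x)

squash-inject₁ : ∀ {m} (j : Fin (suc m)) → squash (inject₁ j) ≡ j
squash-inject₁ {zero}  fz     = refl
squash-inject₁ {suc m} fz     = refl
squash-inject₁ {suc m} (fs j) = cong fs (squash-inject₁ j)

squashAll : ∀ {m} → Vec (Fin (suc m)) m → Vec (Fin m) m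
squashAll {zero}  [] = []
squashAll {suc m} v  = Data.Vec.map squash v

lookup-squashAll : ∀ {m} (v : Vec (Fin (suc m)) m) j u → lookup v j ≡ inject₁ u → lookup (squashAll v) j ≡ u
lookup-squashAll {suc m} v j u e = trans (Vec.lookup-map j squash v) (trans (cong squash e) (squash-inject₁ u))

iter-+ : ∀ {m} (σ : Map m) a b x → iter σ (a + b) x ≡ iter σ a (iter σ b x)
iter-+ σ zero    b x = refl
iter-+ σ (suc a) b x = cong (lookup σ) (iter-+ σ a b x)

Reach : ∀ {m} → Map m → Fin m → Fin m → Set
Reach σ x y = ∃ λ r → iter σ r x ≡ y

reach-trans : ∀ {m} (σ : Map m) {x y z} → Reach σ x y → Reach σ y z → Reach σ x z
reach-trans σ {x} (r , refl) (s , refl) = s + r , iter-+ σ s r x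

reach-step : ∀ {m} (σ : Map m) {x y} → Reach σ x y → Reach σ x (lookup σ y)
reach-step σ (r , refl) = suc r , refl

-- Pigeonhole: the point  σ^(m+1) x  is already reached within  m  steps.
shortcut : ∀ {m} (σ : Map m) x → ∃ λ r → r ≤ m × iter σ r x ≡ iter σ (suc m) x
shortcut {m} σ x with pigeonhole ≤-refl (λ (i : Fin (suc m)) → iter σ (toℕ i) x)
... | i , j , i<j , σⁱx≡σʲx = d + toℕ i , d+i≤m , σᵈ⁺ⁱx≡σᵐ⁺¹x
  where
  d = suc m ∸ toℕ j
  d+j≡m+1 : d + toℕ j ≡ suc m
  d+j≡m+1 = m∸n+n≡m (<⇒≤ (toℕ<n j))
  d+i≤m : d + toℕ i ≤ m
  d+i≤m = ≤-pred (subst (suc (d + toℕ i) ≤_) d+j≡m+1 (+-monoʳ-< d i<j))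
  σᵈ⁺ⁱx≡σᵐ⁺¹x : iter σ (d + toℕ i) x ≡ iter σ (suc m) x
  σᵈ⁺ⁱx≡σᵐ⁺¹x = begin
    iter σ (d + toℕ i) x       ≡⟨ iter-+ σ d (toℕ i) x ⟩
    iter σ d (iter σ (toℕ i) x) ≡⟨ cong (iter σ d) σⁱx≡σʲx ⟩
    iter σ d (iter σ (toℕ j) x) ≡⟨ iter-+ σ d (toℕ j) x ⟨
    iter σ (d + toℕ j) x       ≡⟨ cong (λ r → iter σ r x) d+j≡m+1 ⟩
    iter σ (suc m) x           ∎
    where open ≡-Reasoning

reach-bounded : ∀ {m} (σ : Map m) x r → ∃ λ r′ → r′ ≤ m × iter σ r′ x ≡ iter σ r x
reach-bounded σ x zero = 0 , z≤n , refl
reach-bounded {m} σ x (suc r) with reach-bounded σ x r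
... | r′ , r′≤m , e with m≤n⇒m<n∨m≡n r′≤m
... | inj₁ r′<m  = suc r′ , r′<m , cong (lookup σ) e
... | inj₂ refl = let (r″ , r″≤m , e′) = shortcut σ x in r″ , r″≤m , trans e′ (cong (lookup σ) e)

sameCycle⇒reach : ∀ {m} (σ : Map m) x y → sameCycle σ x y ≡ true → Reach σ x y
sameCycle⇒reach {m} σ x y e with anyL-applyUpTo⇒ (λ r → iter σ r x ==F y) id (suc m) e
... | r , _ , hit = r , ==F-sound _ _ hit

reach⇒sameCycle : ∀ {m} (σ : Map m) x y → Reach σ x y → sameCycle σ x y ≡ true
reach⇒sameCycle {m} σ x y (r , refl) with reach-bounded σ x r
... | r′ , r′≤m , e = anyL-applyUpTo⇐ (λ s → iter σ s x ==F iter σ r x) id (suc m) r′ (s≤s r′≤m)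
    (subst (λ z → (z ==F iter σ r x) ≡ true) (sym e) (==F-refl _))

ConstOnCycles : ∀ {m k} → Map m → Vec (Fin k) m → Set
ConstOnCycles σ c = ∀ i → lookup c (lookup σ i) ≡ lookup c i

constOnCycles⇒ : ∀ {m k} (σ : Map m) (c : Vec (Fin k) m) → constOnCycles σ c ≡ true → ConstOnCycles σ c
constOnCycles⇒ σ c e i = ==F-sound _ _ (allL-tabulate⇒ _ id e i)

constOnCycles⇐ : ∀ {m k} (σ : Map m) (c : Vec (Fin k) m) → ConstOnCycles σ c → constOnCycles σ c ≡ true
constOnCycles⇐ σ c h = allL-tabulate⇐ _ id λ i → subst (λ z → (lookup c (lookup σ i) ==F z) ≡ true) (h i) (==F-refl _)

const-iter : ∀ {m k} (σ : Map m) (c : Vec (Fin k) m) → ConstOnCycles σ c → ∀ r i → lookup c (iter σ r i) ≡ lookup c i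
const-iter σ c h zero    i = refl
const-iter σ c h (suc r) i = trans (h _) (const-iter σ c h r i)

least : ∀ {n} (P : Fin n → Bool) i → P i ≡ true → ∃ λ w → P w ≡ true × (∀ u → P u ≡ true → toℕ w ≤ toℕ u)
least {suc n} P i Pi with P fz in P0
... | true  = fz , P0 , λ _ _ → z≤n
... | false with i
...   | fz    = ⊥-elim (true≢false (trans (sym Pi) P0))
...   | fs i′ with least (P ∘ fs) i′ Pi
...     | w , Pw , w-least = fs w , Pw , minimal
  where
  minimal : ∀ u → P u ≡ true → toℕ (fs w) ≤ toℕ u
  minimal fz     Pu = ⊥-elim (true≢false (trans (sym Pu) P0))
  minimal (fs u) Pu = s≤s (w-least u Pu)

-- If no cycle carries colour  a , then no point carries colour  a : the least
-- point of the cycle of  i  is its representative and has the colour of  i .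
unused-colour : ∀ {m k} (σ : Map m) (c : Vec (Fin k) m) a → constOnCycles σ c ≡ true →
  cyclesWithColour σ c a ≡ 0 → ∀ i → lookup c i ≢ a
unused-colour {m} σ c a const none i cᵢ≡a with least (sameCycle σ i) i (reach⇒sameCycle σ i i (0 , refl))
... | w , i~w , w-least = true≢false (trans (sym (∧-intro w-rep w-coloured)) (countL-zero _ id none w))
  where
  i→w = sameCycle⇒reach σ i w i~w
  w-coloured : (lookup c w ==F a) ≡ true
  w-coloured = subst (λ z → (z ==F a) ≡ true)
    (sym (trans (cong (lookup c) (sym (proj₂ i→w))) (trans (const-iter σ c (constOnCycles⇒ σ c const) (proj₁ i→w) i) cᵢ≡a)))
    (==F-refl a)
  w-rep : isRep σ w ≡ true
  w-rep = allL-tabulate⇐ _ id at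
    where
    at : ∀ u → not (sameCycle σ w u) ∨ (toℕ w ≤ᵇ toℕ u) ≡ true
    at u with sameCycle σ w u in w~u
    ... | false = refl
    ... | true  = T⇒≡true (≤⇒≤ᵇ (w-least u (reach⇒sameCycle σ i u (reach-trans σ i→w (sameCycle⇒reach σ w u w~u)))))

extend : ∀ {m} → (Fin m → Fin (suc m)) → Map m → Fin (suc m) → Map (suc m)
extend g σ′ z = Data.Vec.map g σ′ ∷ʳ z

module _ {m : ℕ} (g : Fin m → Fin (suc m)) (σ′ : Map m) (z : Fin (suc m)) where

  extend-old : ∀ j → lookup (extend g σ′ z) (inject₁ j) ≡ g (lookup σ′ j)
  extend-old j = trans (lookup-∷ʳ-old (Data.Vec.map g σ′) z j) (Vec.lookup-map j g σ′)

  extend-new : lookup (extend g σ′ z) (fromℕ m) ≡ z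
  extend-new = lookup-∷ʳ-new (Data.Vec.map g σ′) z

Injective : ∀ {m} → Map m → Set
Injective σ = ∀ i j → lookup σ i ≡ lookup σ j → i ≡ j

isPerm⇒injective : ∀ {m} (σ : Map m) → isPerm σ ≡ true → Injective σ
isPerm⇒injective σ e i j σi≡σj with allL-tabulate⇒ _ id (allL-tabulate⇒ _ id e i) j
... | h rewrite σi≡σj | ==F-refl (lookup σ j) = ==F-sound i j h

injective⇒isPerm : ∀ {m} (σ : Map m) → Injective σ → isPerm σ ≡ true
injective⇒isPerm σ inj = allL-tabulate⇐ _ id λ i → allL-tabulate⇐ _ id λ j → at i j
  where
  at : ∀ i j → not (lookup σ i ==F lookup σ j) ∨ (i ==F j) ≡ true
  at i j with lookup σ i ==F lookup σ j in σi=σj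
  ... | true rewrite inj i j (==F-sound _ _ σi=σj) = ==F-refl j
  ... | false = refl

isPerm-extend : ∀ {m} (g : Fin m → Fin (suc m)) (σ′ : Map m) z →
  (∀ u v → g u ≡ g v → u ≡ v) → (∀ v → g v ≢ z) → isPerm (extend g σ′ z) ≡ isPerm σ′
isPerm-extend {m} g σ′ z g-inj z-fresh = bool-ext
  (λ e → injective⇒isPerm σ′ (restrict (isPerm⇒injective σ e)))
  (λ e → injective⇒isPerm σ (lift (isPerm⇒injective σ′ e)))
  where
  σ = extend g σ′ z
  restrict : Injective σ → Injective σ′
  restrict h i j q = inject₁-injective (h (inject₁ i) (inject₁ j)
    (trans (extend-old g σ′ z i) (trans (cong g q) (sym (extend-old g σ′ z j)))))
  lift : Injective σ′ → Injective σ
  lift h x y q with finView x | finView y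
  ... | old i | old j = cong inject₁ (h i j (g-inj _ _ (trans (sym (extend-old g σ′ z i)) (trans q (extend-old g σ′ z j)))))
  ... | old i | new   = ⊥-elim (z-fresh _ (trans (sym (extend-old g σ′ z i)) (trans q (extend-new g σ′ z))))
  ... | new   | old j = ⊥-elim (z-fresh _ (trans (sym (extend-old g σ′ z j)) (trans (sym q) (extend-new g σ′ z))))
  ... | new   | new   = refl

constOnCycles-extend : ∀ {m k} (g : Fin m → Fin (suc m)) (σ′ : Map m) z (c′ : Vec (Fin k) m) a →
  (∀ v → lookup (c′ ∷ʳ a) (g v) ≡ lookup c′ v) → lookup (c′ ∷ʳ a) z ≡ a →
  constOnCycles (extend g σ′ z) (c′ ∷ʳ a) ≡ constOnCycles σ′ c′
constOnCycles-extend {m} g σ′ z c′ a g-col z-col = bool-ext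
  (λ e → constOnCycles⇐ σ′ c′ (restrict (constOnCycles⇒ σ c e)))
  (λ e → constOnCycles⇐ σ c (lift (constOnCycles⇒ σ′ c′ e)))
  where
  σ = extend g σ′ z
  c = c′ ∷ʳ a
  colour-old : ∀ j → lookup c (lookup σ (inject₁ j)) ≡ lookup c′ (lookup σ′ j)
  colour-old j = trans (cong (lookup c) (extend-old g σ′ z j)) (g-col _)
  restrict : ConstOnCycles σ c → ConstOnCycles σ′ c′
  restrict h j = trans (sym (colour-old j)) (trans (h (inject₁ j)) (lookup-∷ʳ-old c′ a j))
  lift : ConstOnCycles σ′ c′ → ConstOnCycles σ c
  lift h x with finView x
  ... | old j = trans (colour-old j) (trans (h j) (sym (lookup-∷ʳ-old c′ a j)))
  ... | new   = trans (cong (lookup c) (extend-new g σ′ z)) (trans z-col (sym (lookup-∷ʳ-new c′ a)))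

-- If  σ  restricts to  σ′  on the old points as far as cycles are concerned,
-- old representatives stay representatives (the new point is the largest).
isRep-old : ∀ {m} (σ : Map (suc m)) (σ′ : Map m) →
  (∀ x y → sameCycle σ (inject₁ x) (inject₁ y) ≡ sameCycle σ′ x y) →
  ∀ j → isRep σ (inject₁ j) ≡ isRep σ′ j
isRep-old {m} σ σ′ same j =
  trans (allL-last p id) (trans (cong₂ _∧_ (allL-tabulate p p′ inject₁ id at-old) at-new) (∧-identityʳ _))
  where
  p : Fin (suc m) → Bool
  p w = not (sameCycle σ (inject₁ j) w) ∨ (toℕ (inject₁ j) ≤ᵇ toℕ w)
  p′ : Fin m → Bool
  p′ w = not (sameCycle σ′ j w) ∨ (toℕ j ≤ᵇ toℕ w)
  at-old : ∀ w → p (inject₁ w) ≡ p′ w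
  at-old w = cong₂ _∨_ (cong not (same j w)) (cong₂ _≤ᵇ_ (toℕ-inject₁ j) (toℕ-inject₁ w))
  j≤new : toℕ (inject₁ j) ≤ toℕ (fromℕ m)
  j≤new rewrite toℕ-inject₁ j | toℕ-fromℕ m = <⇒≤ (toℕ<n j)
  at-new : p (fromℕ m) ≡ true
  at-new rewrite T⇒≡true (≤⇒≤ᵇ j≤new) = ∨-zeroʳ _

cyclesWithColour-extend : ∀ {m k} (σ : Map (suc m)) (σ′ : Map m) (c′ : Vec (Fin k) m) a b →
  (∀ x y → sameCycle σ (inject₁ x) (inject₁ y) ≡ sameCycle σ′ x y) →
  cyclesWithColour σ (c′ ∷ʳ a) b ≡ cyclesWithColour σ′ c′ b + indicator (isRep σ (fromℕ m) ∧ (a ==F b))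
cyclesWithColour-extend {m} σ σ′ c′ a b same =
  trans (countL-last p id) (cong₂ _+_ (countL-tabulate p p′ inject₁ id at-old) (cong (λ u → indicator (isRep σ (fromℕ m) ∧ (u ==F b))) (lookup-∷ʳ-new c′ a)))
  where
  p = λ i → isRep σ i ∧ (lookup (c′ ∷ʳ a) i ==F b)
  p′ = λ i → isRep σ′ i ∧ (lookup c′ i ==F b)
  at-old : ∀ i → p (inject₁ i) ≡ p′ i
  at-old i = cong₂ (λ u v → u ∧ (v ==F b)) (isRep-old σ σ′ same i) (lookup-∷ʳ-old c′ a i)

addFixedPoint : ∀ {m} → Map m → Map (suc m)
addFixedPoint {m} σ′ = extend inject₁ σ′ (fromℕ m)

module _ {m : ℕ} (σ′ : Map m) where
  private σ = addFixedPoint σ′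

  iter-fixed-old : ∀ r x → iter σ r (inject₁ x) ≡ inject₁ (iter σ′ r x)
  iter-fixed-old zero    x = refl
  iter-fixed-old (suc r) x = trans (cong (lookup σ) (iter-fixed-old r x)) (extend-old inject₁ σ′ (fromℕ m) _)

  iter-fixed-new : ∀ r → iter σ r (fromℕ m) ≡ fromℕ m
  iter-fixed-new zero    = refl
  iter-fixed-new (suc r) = trans (cong (lookup σ) (iter-fixed-new r)) (extend-new inject₁ σ′ (fromℕ m))

  sameCycle-fixed-old : ∀ x y → sameCycle σ (inject₁ x) (inject₁ y) ≡ sameCycle σ′ x y
  sameCycle-fixed-old x y = bool-ext
    (λ e → let (r , q) = sameCycle⇒reach σ (inject₁ x) (inject₁ y) e in
           reach⇒sameCycle σ′ x y (r , inject₁-injective (trans (sym (iter-fixed-old r x)) q)))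
    (λ e → let (r , q) = sameCycle⇒reach σ′ x y e in
           reach⇒sameCycle σ (inject₁ x) (inject₁ y) (r , trans (iter-fixed-old r x) (cong inject₁ q)))

  sameCycle-fixed-new : ∀ y → sameCycle σ (fromℕ m) (inject₁ y) ≡ false
  sameCycle-fixed-new y = not-true⇒false λ e →
    let (r , q) = sameCycle⇒reach σ (fromℕ m) (inject₁ y) e in old≢new y (sym (trans (sym (iter-fixed-new r)) q))

  isRep-fixed-new : isRep σ (fromℕ m) ≡ true
  isRep-fixed-new = allL-tabulate⇐ _ id at
    where
    at : ∀ w → not (sameCycle σ (fromℕ m) w) ∨ (toℕ (fromℕ m) ≤ᵇ toℕ w) ≡ true
    at w with finView w
    ... | old y rewrite sameCycle-fixed-new y = refl
    ... | new   rewrite T⇒≡true (≤⇒≤ᵇ (≤-refl {toℕ (fromℕ m)})) = ∨-zeroʳ _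

  isPerm-addFixedPoint : isPerm σ ≡ isPerm σ′
  isPerm-addFixedPoint = isPerm-extend inject₁ σ′ (fromℕ m) (λ _ _ → inject₁-injective) old≢new

  constOnCycles-addFixedPoint : ∀ {k} (c′ : Vec (Fin k) m) a → constOnCycles σ (c′ ∷ʳ a) ≡ constOnCycles σ′ c′
  constOnCycles-addFixedPoint c′ a = constOnCycles-extend inject₁ σ′ (fromℕ m) c′ a (lookup-∷ʳ-old c′ a) (lookup-∷ʳ-new c′ a)

  cyclesWithColour-addFixedPoint : ∀ {k} (c′ : Vec (Fin k) m) a b →
    cyclesWithColour σ (c′ ∷ʳ a) b ≡ cyclesWithColour σ′ c′ b + indicator (a ==F b)
  cyclesWithColour-addFixedPoint c′ a b =
    trans (cyclesWithColour-extend σ σ′ c′ a b sameCycle-fixed-old) (cong (λ u → cyclesWithColour σ′ c′ b + indicator (u ∧ (a ==F b))) isRep-fixed-new)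

-- Inserting the new point into an existing cycle, immediately before  s :
-- the predecessor of  s  now points to the new point, which points to  s .

redirect : ∀ {m} → Fin m → Fin m → Fin (suc m)
redirect {m} s v = if v ==F s then fromℕ m else inject₁ v

insertBefore : ∀ {m} → Map m → Fin m → Map (suc m)
insertBefore σ′ s = extend (redirect s) σ′ (inject₁ s)

module _ {m : ℕ} (s : Fin m) where

  redirect-hit : ∀ v → (v ==F s) ≡ true → redirect s v ≡ fromℕ m
  redirect-hit v e rewrite e = refl

  redirect-miss : ∀ v → (v ==F s) ≡ false → redirect s v ≡ inject₁ v
  redirect-miss v e rewrite e = refl

  redirect-injective : ∀ u v → redirect s u ≡ redirect s v → u ≡ v
  redirect-injective u v q with u ==F s in us | v ==F s in vs
  ... | true  | true  = trans (==F-sound _ _ us) (sym (==F-sound _ _ vs))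
  ... | true  | false = ⊥-elim (old≢new v (sym q))
  ... | false | true  = ⊥-elim (old≢new u q)
  ... | false | false = inject₁-injective q

  redirect-fresh : ∀ v → redirect s v ≢ inject₁ s
  redirect-fresh v q with v ==F s in vs
  ... | true  = old≢new s (sym q)
  ... | false = true≢false (trans (sym (subst (λ u → (u ==F s) ≡ true) (sym (inject₁-injective q)) (==F-refl s))) vs)

module _ {m : ℕ} (σ′ : Map m) (s : Fin m) where
  private σ = insertBefore σ′ s

  insertBefore-old : ∀ j → lookup σ (inject₁ j) ≡ redirect s (lookup σ′ j)
  insertBefore-old = extend-old (redirect s) σ′ (inject₁ s)

  insertBefore-new : lookup σ (fromℕ m) ≡ inject₁ s
  insertBefore-new = extend-new (redirect s) σ′ (inject₁ s)

  -- One step of  σ′  is one or two steps of  σ .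
  reach-inserted-step : ∀ x w → Reach σ (inject₁ x) (inject₁ w) → Reach σ (inject₁ x) (inject₁ (lookup σ′ w))
  reach-inserted-step x w h with lookup σ′ w ==F s in hit
  ... | true  = subst (Reach σ (inject₁ x)) (trans insertBefore-new (cong inject₁ (sym (==F-sound _ _ hit))))
                  (reach-step σ (subst (Reach σ (inject₁ x)) (trans (insertBefore-old w) (redirect-hit s _ hit)) (reach-step σ h)))
  ... | false = subst (Reach σ (inject₁ x)) (trans (insertBefore-old w) (redirect-miss s _ hit)) (reach-step σ h)

  reach-inserted⇐ : ∀ x r → Reach σ (inject₁ x) (inject₁ (iter σ′ r x))
  reach-inserted⇐ x zero    = 0 , refl
  reach-inserted⇐ x (suc r) = reach-inserted-step x _ (reach-inserted⇐ x r)

  IterateOf : Fin m → Fin (suc m) → Set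
  IterateOf x w = (∃ λ j → w ≡ inject₁ j × Reach σ′ x j) ⊎ (w ≡ fromℕ m × Reach σ′ x s)

  iterate-inserted : ∀ x r → IterateOf x (iter σ r (inject₁ x))
  iterate-inserted x zero = inj₁ (x , refl , 0 , refl)
  iterate-inserted x (suc r) with iterate-inserted x r
  ... | inj₂ (at-new , x→s) = inj₁ (s , trans (cong (lookup σ) at-new) insertBefore-new , x→s)
  ... | inj₁ (j , at-j , x→j) with lookup σ′ j ==F s in hit
  ... | true  = inj₂ (trans (cong (lookup σ) at-j) (trans (insertBefore-old j) (redirect-hit s _ hit)) ,
                      subst (Reach σ′ x) (==F-sound _ _ hit) (reach-step σ′ x→j))
  ... | false = inj₁ (lookup σ′ j , trans (cong (lookup σ) at-j) (trans (insertBefore-old j) (redirect-miss s _ hit)) , reach-step σ′ x→j)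

  sameCycle-inserted-old : ∀ x y → sameCycle σ (inject₁ x) (inject₁ y) ≡ sameCycle σ′ x y
  sameCycle-inserted-old x y = bool-ext
    (λ e → let (r , q) = sameCycle⇒reach σ (inject₁ x) (inject₁ y) e in reach⇒sameCycle σ′ x y (old-iterate r q (iterate-inserted x r)))
    (λ e → let (r , q) = sameCycle⇒reach σ′ x y e in
           reach⇒sameCycle σ (inject₁ x) (inject₁ y) (subst (λ z → Reach σ (inject₁ x) (inject₁ z)) q (reach-inserted⇐ x r)))
    where
    old-iterate : ∀ r → iter σ r (inject₁ x) ≡ inject₁ y → IterateOf x (iter σ r (inject₁ x)) → Reach σ′ x y
    old-iterate r q (inj₁ (j , at-j , x→j)) = subst (Reach σ′ x) (inject₁-injective (trans (sym at-j) q)) x→j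
    old-iterate r q (inj₂ (at-new , _))     = ⊥-elim (old≢new y (trans (sym q) at-new))

  -- The new point lies on the cycle of the smaller point  s , so it is no representative.
  isRep-inserted-new : isRep σ (fromℕ m) ≡ false
  isRep-inserted-new = not-true⇒false λ e → too-large (allL-tabulate⇒ _ id e (inject₁ s))
    where
    too-large : not (sameCycle σ (fromℕ m) (inject₁ s)) ∨ (toℕ (fromℕ m) ≤ᵇ toℕ (inject₁ s)) ≡ true → ⊥
    too-large e rewrite reach⇒sameCycle σ (fromℕ m) (inject₁ s) (1 , insertBefore-new) | toℕ-fromℕ m | toℕ-inject₁ s =
      <-irrefl refl (≤-trans (toℕ<n s) (≤ᵇ⇒≤ m (toℕ s) (≡true⇒T e)))

  isPerm-insertBefore : isPerm σ ≡ isPerm σ′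
  isPerm-insertBefore = isPerm-extend (redirect s) σ′ (inject₁ s) (redirect-injective s) (redirect-fresh s)

  constOnCycles-insertBefore : ∀ {k} (c′ : Vec (Fin k) m) a →
    constOnCycles σ (c′ ∷ʳ a) ≡ constOnCycles σ′ c′ ∧ (a ==F lookup c′ s)
  constOnCycles-insertBefore c′ a with a ==F lookup c′ s in a=cs
  ... | true  = trans (constOnCycles-extend (redirect s) σ′ (inject₁ s) c′ a redirect-col (trans (lookup-∷ʳ-old c′ a s) (sym a≡cs)))
                      (sym (∧-identityʳ _))
    where
    a≡cs = ==F-sound _ _ a=cs
    redirect-col : ∀ v → lookup (c′ ∷ʳ a) (redirect s v) ≡ lookup c′ v
    redirect-col v with v ==F s in vs
    ... | true  = trans (lookup-∷ʳ-new c′ a) (trans a≡cs (cong (lookup c′) (sym (==F-sound _ _ vs))))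
    ... | false = lookup-∷ʳ-old c′ a v
  ... | false = trans (not-true⇒false λ e → true≢false (trans (sym (colour-forced (constOnCycles⇒ σ (c′ ∷ʳ a) e))) a=cs)) (sym (∧-zeroʳ (constOnCycles σ′ c′)))
    where
    colour-forced : ConstOnCycles σ (c′ ∷ʳ a) → (a ==F lookup c′ s) ≡ true
    colour-forced h = subst (λ u → (a ==F u) ≡ true)
      (trans (sym (lookup-∷ʳ-new c′ a)) (trans (sym (h (fromℕ m))) (trans (cong (lookup (c′ ∷ʳ a)) insertBefore-new) (lookup-∷ʳ-old c′ a s))))
      (==F-refl a)

  -- No new cycle: colour counts are unchanged.
  cyclesWithColour-insertBefore : ∀ {k} (c′ : Vec (Fin k) m) a b → cyclesWithColour σ (c′ ∷ʳ a) b ≡ cyclesWithColour σ′ c′ b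
  cyclesWithColour-insertBefore c′ a b =
    trans (cyclesWithColour-extend σ σ′ c′ a b sameCycle-inserted-old)
          (trans (cong (λ u → cyclesWithColour σ′ c′ b + indicator (u ∧ (a ==F b))) isRep-inserted-new) (+-identityʳ _))

countCondition : ∀ {k} → ℕ → (Fin k → ℕ) → Bool
countCondition {k} t count =
  allL (λ a → if isSpecial a then ⌊ count a ≟N t ⌋ else ⌊ count a ≟N 1 ⌋) (allFin k)

countCondition-cong : ∀ {k} t (f g : Fin k → ℕ) → (∀ a → f a ≡ g a) → countCondition t f ≡ countCondition t g
countCondition-cong {k} t f g e =
  allL-cong (allFin k) (λ a → cong (λ n → if isSpecial a then ⌊ n ≟N t ⌋ else ⌊ n ≟N 1 ⌋) (e a))

⌊suc≟suc⌋ : ∀ n t → ⌊ suc n ≟N suc t ⌋ ≡ ⌊ n ≟N t ⌋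
⌊suc≟suc⌋ n t = bool-ext
  (λ e → isYes⇐ (n ≟N t) (suc-injective (isYes⇒ (suc n ≟N suc t) e)))
  (λ e → isYes⇐ (suc n ≟N suc t) (cong suc (isYes⇒ (n ≟N t) e)))

mixed-fixed-special : ∀ {m k} t (σ′ : Map m) (c′ : Vec (Fin (suc k)) m) →
  isMixedColoured (suc t) (addFixedPoint σ′) (c′ ∷ʳ fz) ≡ isMixedColoured t σ′ c′
mixed-fixed-special t σ′ c′ =
  cong₂ _∧_ (isPerm-addFixedPoint σ′)
    (cong₂ _∧_ (constOnCycles-addFixedPoint σ′ c′ fz)
      (trans (countCondition-cong _ _ _ (cyclesWithColour-addFixedPoint σ′ c′ fz)) (allL-tabulate _ _ id id at)))
  where
  count′ = cyclesWithColour σ′ c′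
  at : ∀ b → (if isSpecial b then ⌊ count′ b + indicator (fz ==F b) ≟N suc t ⌋ else ⌊ count′ b + indicator (fz ==F b) ≟N 1 ⌋)
           ≡ (if isSpecial b then ⌊ count′ b ≟N t ⌋ else ⌊ count′ b ≟N 1 ⌋)
  at fz     = trans (cong (λ n → ⌊ n ≟N suc t ⌋) (+-comm (count′ fz) 1)) (⌊suc≟suc⌋ (count′ fz) t)
  at (fs b) rewrite +-identityʳ (count′ (fs b)) = refl

==F-injective : ∀ {k l} (f : Fin k → Fin l) → (∀ x y → f x ≡ f y → x ≡ y) → ∀ x y → (f x ==F f y) ≡ (x ==F y)
==F-injective f f-inj x y = bool-ext
  (λ e → subst (λ z → (x ==F z) ≡ true) (f-inj x y (==F-sound _ _ e)) (==F-refl x))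
  (λ e → subst (λ z → (f x ==F f z) ≡ true) (==F-sound _ _ e) (==F-refl (f x)))

constOnCycles-recolour : ∀ {m k l} (σ : Map m) (c : Vec (Fin k) m) (f : Fin k → Fin l) → (∀ x y → f x ≡ f y → x ≡ y) →
  constOnCycles σ (Data.Vec.map f c) ≡ constOnCycles σ c
constOnCycles-recolour {m} σ c f f-inj = allL-cong (allFin m) λ i →
  trans (cong₂ _==F_ (Vec.lookup-map (lookup σ i) f c) (Vec.lookup-map i f c)) (==F-injective f f-inj _ _)

cyclesWithColour-recolour : ∀ {m k l} (σ : Map m) (c : Vec (Fin k) m) (f : Fin k → Fin l) → (∀ x y → f x ≡ f y → x ≡ y) →
  ∀ b → cyclesWithColour σ (Data.Vec.map f c) (f b) ≡ cyclesWithColour σ c b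
cyclesWithColour-recolour {m} σ c f f-inj b = countL-cong (allFin m) λ i →
  cong (isRep σ i ∧_) (trans (cong (_==F f b) (Vec.lookup-map i f c)) (==F-injective f f-inj _ _))

cyclesWithColour-missing : ∀ {m k l} (σ : Map m) (c : Vec (Fin k) m) (f : Fin k → Fin l) a → (∀ x → f x ≢ a) →
  cyclesWithColour σ (Data.Vec.map f c) a ≡ 0
cyclesWithColour-missing {m} σ c f a missing = trans (countL-cong (allFin m) at) (countL-none (allFin m))
  where
  at : ∀ i → isRep σ i ∧ (lookup (Data.Vec.map f c) i ==F a) ≡ false
  at i rewrite Vec.lookup-map i f c | ==F-false (f (lookup c i)) a (missing _) = ∧-zeroʳ (isRep σ i)

allL-punchIn : ∀ {k} (p : Fin (suc k) → Bool) a → allL p (allFin (suc k)) ≡ p a ∧ allL (p ∘ punchIn a) (allFin k)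
allL-punchIn {k} p a = bool-ext
  (λ e → ∧-intro (allL-tabulate⇒ p id e a) (allL-tabulate⇐ (p ∘ punchIn a) id (allL-tabulate⇒ p id e ∘ punchIn a)))
  (λ e → allL-tabulate⇐ p id (every (∧-true₁ e) (allL-tabulate⇒ (p ∘ punchIn a) id (∧-true₂ {p a} e))))
  where
  every : p a ≡ true → (∀ b → p (punchIn a b) ≡ true) → ∀ x → p x ≡ true
  every pa rest x with a ≟F x
  ... | yes refl = pa
  ... | no a≢x   = subst (λ z → p z ≡ true) (punchIn-punchOut a≢x) (rest _)

mixed-fixed-fresh : ∀ {m k} t (σ′ : Map m) j (c″ : Vec (Fin k) m) →
  isMixedColoured t (addFixedPoint σ′) (Data.Vec.map (punchIn (fs j)) c″ ∷ʳ fs j) ≡ isMixedColoured t σ′ c″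
mixed-fixed-fresh {m} {k} t σ′ j c″ =
  cong₂ _∧_ (isPerm-addFixedPoint σ′)
    (cong₂ _∧_ (trans (constOnCycles-addFixedPoint σ′ c′ a) (constOnCycles-recolour σ′ c″ (punchIn a) (punchIn-injective a)))
      (trans (countCondition-cong _ _ _ (cyclesWithColour-addFixedPoint σ′ c′ a))
        (trans (allL-punchIn _ a) (cong₂ _∧_ at-fresh (allL-tabulate _ _ id id at-rest)))))
  where
  a = fs j
  c′ = Data.Vec.map (punchIn a) c″
  count′ = cyclesWithColour σ′ c′
  at-fresh : (if isSpecial a then ⌊ count′ a + indicator (a ==F a) ≟N t ⌋ else ⌊ count′ a + indicator (a ==F a) ≟N 1 ⌋) ≡ true
  at-fresh rewrite cyclesWithColour-missing σ′ c″ (punchIn a) a (punchInᵢ≢i a) | ==F-refl a = refl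
  isSpecial-punchIn : ∀ b → isSpecial (punchIn a b) ≡ isSpecial b
  isSpecial-punchIn fz     = refl
  isSpecial-punchIn (fs b) = refl
  at-rest : ∀ b →
    (if isSpecial (punchIn a b) then ⌊ count′ (punchIn a b) + indicator (a ==F punchIn a b) ≟N t ⌋
                                else ⌊ count′ (punchIn a b) + indicator (a ==F punchIn a b) ≟N 1 ⌋)
    ≡ (if isSpecial b then ⌊ cyclesWithColour σ′ c″ b ≟N t ⌋ else ⌊ cyclesWithColour σ′ c″ b ≟N 1 ⌋)
  at-rest b rewrite isSpecial-punchIn b | ==F-false a (punchIn a b) (λ e → punchInᵢ≢i a b (sym e))
                  | +-identityʳ (count′ (punchIn a b)) | cyclesWithColour-recolour σ′ c″ (punchIn a) (punchIn-injective a) b = refl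

mixed-inserted : ∀ {m k} t (σ′ : Map m) s (c′ : Vec (Fin k) m) a →
  isMixedColoured t (insertBefore σ′ s) (c′ ∷ʳ a) ≡ isMixedColoured t σ′ c′ ∧ (a ==F lookup c′ s)
mixed-inserted t σ′ s c′ a =
  trans (cong₂ _∧_ (isPerm-insertBefore σ′ s)
          (cong₂ _∧_ (constOnCycles-insertBefore σ′ s c′ a) (countCondition-cong t _ _ (cyclesWithColour-insertBefore σ′ s c′ a))))
        (rearrange (isPerm σ′) (constOnCycles σ′ c′) _ _)
  where
  rearrange : ∀ p c a x → p ∧ ((c ∧ a) ∧ x) ≡ (p ∧ c ∧ x) ∧ a
  rearrange true  true  true  x = sym (∧-identityʳ x)
  rearrange true  true  false x = sym (∧-zeroʳ x)
  rearrange true  false a     x = refl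
  rearrange false c     a     x = refl

last-extend : ∀ {m} g (σ′ : Map m) z → last (extend g σ′ z) ≡ z
last-extend g σ′ z = Vec.last-∷ʳ z (Data.Vec.map g σ′)

removeFixedPoint : ∀ {m} → Map (suc m) → Map m
removeFixedPoint σ = squashAll (init σ)

removeFixedPoint-addFixedPoint : ∀ {m} (σ′ : Map m) → removeFixedPoint (addFixedPoint σ′) ≡ σ′
removeFixedPoint-addFixedPoint σ′ = vec-ext _ σ′ λ j →
  lookup-squashAll (init (addFixedPoint σ′)) j _ (trans (lookup-init (addFixedPoint σ′) j) (extend-old inject₁ σ′ _ j))

addFixedPoint-removeFixedPoint : ∀ {m} (σ : Map (suc m)) → isPerm σ ≡ true → last σ ≡ fromℕ m →
  addFixedPoint (removeFixedPoint σ) ≡ σ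
addFixedPoint-removeFixedPoint {m} σ perm fixed = vec-ext _ σ at
  where
  σ-new : lookup σ (fromℕ m) ≡ fromℕ m
  σ-new = trans (sym (last≡lookup-new σ)) fixed
  at : ∀ x → lookup (addFixedPoint (removeFixedPoint σ)) x ≡ lookup σ x
  at x with finView x
  ... | new   = trans (extend-new inject₁ (removeFixedPoint σ) (fromℕ m)) (sym σ-new)
  ... | old j with old-or-new (lookup σ (inject₁ j))
  ...   | inj₂ σj≡new      = ⊥-elim (old≢new j (isPerm⇒injective σ perm _ _ (trans σj≡new (sym σ-new))))
  ...   | inj₁ (u , σj≡u) = trans (extend-old inject₁ (removeFixedPoint σ) (fromℕ m) j)
          (trans (cong inject₁ (lookup-squashAll (init σ) j u (trans (lookup-init σ j) σj≡u))) (sym σj≡u))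

bypass : ∀ {m} → Map (suc m) → Fin (suc m) → Fin (suc m)
bypass {m} σ w = if w ==F fromℕ m then last σ else w

removeInserted : ∀ {m} → Map (suc m) → Map m
removeInserted σ = squashAll (Data.Vec.map (bypass σ) (init σ))

lookup-removeInserted : ∀ {m} (σ : Map (suc m)) j u → bypass σ (lookup σ (inject₁ j)) ≡ inject₁ u → lookup (removeInserted σ) j ≡ u
lookup-removeInserted σ j u e =
  lookup-squashAll _ j u (trans (Vec.lookup-map j (bypass σ) (init σ)) (trans (cong (bypass σ) (lookup-init σ j)) e))

bypass-new : ∀ {m} (σ : Map (suc m)) → bypass σ (fromℕ m) ≡ last σ
bypass-new {m} σ rewrite ==F-refl (fromℕ m) = refl

bypass-old : ∀ {m} (σ : Map (suc m)) u → bypass σ (inject₁ u) ≡ inject₁ u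
bypass-old {m} σ u rewrite ==F-false (inject₁ u) (fromℕ m) (old≢new u) = refl

removeInserted-insertBefore : ∀ {m} (σ′ : Map m) s → removeInserted (insertBefore σ′ s) ≡ σ′
removeInserted-insertBefore {m} σ′ s = vec-ext _ σ′ λ j →
  lookup-removeInserted σ j _ (trans (cong (bypass σ) (insertBefore-old σ′ s j)) (bypass-redirect (lookup σ′ j)))
  where
  σ = insertBefore σ′ s
  bypass-redirect : ∀ v → bypass σ (redirect s v) ≡ inject₁ v
  bypass-redirect v with v ==F s in v=s
  ... | true  = trans (bypass-new σ) (trans (last-extend (redirect s) σ′ (inject₁ s)) (cong inject₁ (sym (==F-sound _ _ v=s))))
  ... | false = bypass-old σ v

insertBefore-removeInserted : ∀ {m} (σ : Map (suc m)) s → isPerm σ ≡ true → last σ ≡ inject₁ s →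
  insertBefore (removeInserted σ) s ≡ σ
insertBefore-removeInserted {m} σ s perm last≡s = vec-ext _ σ at
  where
  σ-new : lookup σ (fromℕ m) ≡ inject₁ s
  σ-new = trans (sym (last≡lookup-new σ)) last≡s
  at : ∀ x → lookup (insertBefore (removeInserted σ) s) x ≡ lookup σ x
  at x with finView x
  ... | new = trans (insertBefore-new (removeInserted σ) s) (sym σ-new)
  ... | old j with old-or-new (lookup σ (inject₁ j))
  ...   | inj₂ σj≡new = trans (insertBefore-old (removeInserted σ) s j) (trans (cong (redirect s) removed≡s)
                          (trans (redirect-hit s s (==F-refl s)) (sym σj≡new)))
    where
    removed≡s : lookup (removeInserted σ) j ≡ s
    removed≡s = lookup-removeInserted σ j s (trans (cong (bypass σ) σj≡new) (trans (bypass-new σ) last≡s))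
  ...   | inj₁ (u , σj≡u) = trans (insertBefore-old (removeInserted σ) s j) (trans (cong (redirect s) removed≡u)
                              (trans (redirect-miss s u u≠s) (sym σj≡u)))
    where
    removed≡u : lookup (removeInserted σ) j ≡ u
    removed≡u = lookup-removeInserted σ j u (trans (cong (bypass σ) σj≡u) (bypass-old σ u))
    -- u = s would make  σ  hit  inject₁ s  twice, at  inject₁ j  and at the new point.
    u≠s : (u ==F s) ≡ false
    u≠s = not-true⇒false λ e → old≢new j (isPerm⇒injective σ perm _ _
            (trans σj≡u (trans (cong inject₁ (==F-sound _ _ e)) (sym σ-new))))

Coloured : ℕ → ℕ → Set
Coloured m k = Map m × Vec (Fin k) m

coloureds : ∀ m k → Enum (Coloured m k)
coloureds m k = EnumPair (EnumVec (EnumFin m) m) (EnumVec (EnumFin k) m)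

mixed : ∀ {m k} → ℕ → Coloured m k → Bool
mixed t p = isMixedColoured t (proj₁ p) (proj₂ p)

mixedColoured-as-count : ∀ m k t → mixedColoured m k t ≡ countL (mixed t) (list (coloureds m k))
mixedColoured-as-count m k t = sym (trans (countL-concatMap _ (λ σ → map (σ ,_) colourings) maps)
  (sumL-cong maps λ σ → countL-map _ (σ ,_) colourings))
  where
  maps = allVecs (allFin m) m
  colourings = allVecs (allFin k) m

newFixed : ∀ {m k} → Coloured (suc m) k → Bool
newFixed {m} p = last (proj₁ p) ==F fromℕ m

newSpecial : ∀ {m k} → Coloured (suc m) (suc k) → Bool
newSpecial p = last (proj₂ p) ==F fz

module FixedSpecial (m k t : ℕ) where

  Q : Coloured (suc m) (suc k) → Bool
  Q p = (mixed (suc t) p ∧ newFixed p) ∧ newSpecial p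

  add : Coloured m (suc k) → Coloured (suc m) (suc k)
  add (σ′ , c′) = addFixedPoint σ′ , c′ ∷ʳ fz

  remove : ∀ p → Q p ≡ true → Coloured m (suc k)
  remove (σ , c) _ = removeFixedPoint σ , init c

  Q-add : ∀ y → Q (add y) ≡ mixed t y
  Q-add (σ′ , c′) = trans (cong₂ _∧_ (cong₂ _∧_ (mixed-fixed-special t σ′ c′) (≡⇒==F (last-extend inject₁ σ′ _)))
                                      (≡⇒==F (Vec.last-∷ʳ fz c′)))
                          (∧-true-true _)

  add-remove : ∀ p q → add (remove p q) ≡ p
  add-remove (σ , c) q = cong₂ _,_
    (addFixedPoint-removeFixedPoint σ (∧-true₁ (∧-true₁ (∧-true₁ q))) (==F-sound _ _ (∧-true₂ {mixed (suc t) (σ , c)} (∧-true₁ q))))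
    (trans (cong (init c ∷ʳ_) (sym (==F-sound _ _ (∧-true₂ {mixed (suc t) (σ , c) ∧ _} q)))) (init-∷ʳ-last c))

  remove-add : ∀ y → mixed t y ≡ true → ∀ q → remove (add y) q ≡ y
  remove-add (σ′ , c′) _ _ = cong₂ _,_ (removeFixedPoint-addFixedPoint σ′) (Vec.init-∷ʳ fz c′)

  count : countL Q (list (coloureds (suc m) (suc k))) ≡ mixedColoured m (suc k) t
  count = trans (bijective-count (coloureds (suc m) (suc k)) (coloureds m (suc k)) Q (mixed t) remove add Q-add add-remove remove-add)
                (sym (mixedColoured-as-count m (suc k) t))

pinch-punchIn : ∀ {k} (j b : Fin k) → pinch j (punchIn (fs j) b) ≡ b
pinch-punchIn j      fz     = refl
pinch-punchIn fz     (fs b) = refl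
pinch-punchIn (fs j) (fs b) = cong fs (pinch-punchIn j b)

punchIn-pinch : ∀ {k} (j : Fin k) (v : Fin (suc k)) → v ≢ fs j → punchIn (fs j) (pinch j v) ≡ v
punchIn-pinch {suc k} j      fz          v≢j = refl
punchIn-pinch {suc k} fz     (fs fz)     v≢j = ⊥-elim (v≢j refl)
punchIn-pinch {suc k} fz     (fs (fs v)) v≢j = refl
punchIn-pinch {suc k} (fs j) (fs v)      v≢j = cong fs (punchIn-pinch j v (v≢j ∘ cong fs))

nonSpecial : ∀ {k} (a : Fin (suc k)) → (a ==F fz) ≡ false → Fin k
nonSpecial (fs j) _ = j

fs-nonSpecial : ∀ {k} (a : Fin (suc k)) p → fs (nonSpecial a p) ≡ a
fs-nonSpecial (fs j) _ = refl

nonSpecial-fs : ∀ {k} {j : Fin k} a p → a ≡ fs j → nonSpecial a p ≡ j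
nonSpecial-fs _ _ refl = refl

fresh-colour-unused : ∀ {m k} t (σ′ : Map m) (c′ : Vec (Fin (suc k)) m) j →
  isMixedColoured t (addFixedPoint σ′) (c′ ∷ʳ fs j) ≡ true → ∀ i → lookup c′ i ≢ fs j
fresh-colour-unused t σ′ c′ j mix = unused-colour σ′ c′ (fs j) const none
  where
  σ = addFixedPoint σ′
  const : constOnCycles σ′ c′ ≡ true
  const = trans (sym (constOnCycles-addFixedPoint σ′ c′ (fs j))) (∧-true₁ (∧-true₂ {isPerm σ} mix))
  one : cyclesWithColour σ (c′ ∷ʳ fs j) (fs j) ≡ 1
  one = isYes⇒ (_ ≟N 1) (allL-tabulate⇒ _ id (∧-true₂ {constOnCycles σ (c′ ∷ʳ fs j)} (∧-true₂ {isPerm σ} mix)) (fs j))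
  none : cyclesWithColour σ′ c′ (fs j) ≡ 0
  none = +-cancelʳ-≡ 1 _ 0 (begin
    cyclesWithColour σ′ c′ (fs j) + 1                             ≡⟨ cong (λ b → cyclesWithColour σ′ c′ (fs j) + indicator b) (==F-refl (fs j)) ⟨
    cyclesWithColour σ′ c′ (fs j) + indicator (fs j ==F fs j)     ≡⟨ cyclesWithColour-addFixedPoint σ′ c′ (fs j) (fs j) ⟨
    cyclesWithColour σ (c′ ∷ʳ fs j) (fs j)                        ≡⟨ one ⟩
    1                                                             ∎)
    where open ≡-Reasoning

module FixedFresh (m k t : ℕ) where

  Q : Coloured (suc m) (suc k) → Bool
  Q p = (mixed t p ∧ newFixed p) ∧ not (newSpecial p)

  R : Fin k × Coloured m k → Bool
  R y = mixed t (proj₂ y)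

  add : Fin k × Coloured m k → Coloured (suc m) (suc k)
  add (j , σ′ , c″) = addFixedPoint σ′ , Data.Vec.map (punchIn (fs j)) c″ ∷ʳ fs j

  removeColour : Coloured (suc m) (suc k) → Fin k → Fin k × Coloured m k
  removeColour (σ , c) j = j , removeFixedPoint σ , Data.Vec.map (pinch j) (init c)

  remove : ∀ p → Q p ≡ true → Fin k × Coloured m k
  remove p q = removeColour p (nonSpecial (last (proj₂ p)) (not≡true⇒false (∧-true₂ {mixed t p ∧ newFixed p} q)))

  Q-add : ∀ y → Q (add y) ≡ R y
  Q-add (j , σ′ , c″) = trans (cong₂ _∧_ (cong₂ _∧_ (mixed-fixed-fresh t σ′ j c″) (≡⇒==F (last-extend inject₁ σ′ _)))
                                          (cong not (cong (_==F fz) (Vec.last-∷ʳ (fs j) (Data.Vec.map (punchIn (fs j)) c″)))))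
                              (∧-true-true _)

  remove-add : ∀ y → R y ≡ true → ∀ q → remove (add y) q ≡ y
  remove-add (j , σ′ , c″) _ q = trans (cong (removeColour (add (j , σ′ , c″))) (nonSpecial-fs _ _ (Vec.last-∷ʳ (fs j) c′)))
    (cong (j ,_) (cong₂ _,_ (removeFixedPoint-addFixedPoint σ′)
      (vec-ext _ c″ λ i → begin
        lookup (Data.Vec.map (pinch j) (init (c′ ∷ʳ fs j))) i ≡⟨ Vec.lookup-map i (pinch j) (init (c′ ∷ʳ fs j)) ⟩
        pinch j (lookup (init (c′ ∷ʳ fs j)) i)             ≡⟨ cong (λ v → pinch j (lookup v i)) (Vec.init-∷ʳ (fs j) c′) ⟩
        pinch j (lookup c′ i)                              ≡⟨ cong (pinch j) (Vec.lookup-map i (punchIn (fs j)) c″) ⟩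
        pinch j (punchIn (fs j) (lookup c″ i))             ≡⟨ pinch-punchIn j _ ⟩
        lookup c″ i                                        ∎)))
    where
    open ≡-Reasoning
    c′ = Data.Vec.map (punchIn (fs j)) c″

  add-removeColour : ∀ σ c → mixed t (σ , c) ≡ true → last σ ≡ fromℕ m → ∀ j → last c ≡ fs j →
    add (removeColour (σ , c) j) ≡ (σ , c)
  add-removeColour σ c mix fixed j last≡j = cong₂ _,_ σ-restored c-restored
    where
    σ′ = removeFixedPoint σ
    c′ = init c
    σ-restored : addFixedPoint σ′ ≡ σ
    σ-restored = addFixedPoint-removeFixedPoint σ (∧-true₁ mix) fixed
    c-split : c′ ∷ʳ fs j ≡ c
    c-split = trans (cong (c′ ∷ʳ_) (sym last≡j)) (init-∷ʳ-last c)
    unused : ∀ i → lookup c′ i ≢ fs j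
    unused = fresh-colour-unused t σ′ c′ j (subst₂ (λ a b → isMixedColoured t a b ≡ true) (sym σ-restored) (sym c-split) mix)
    c-restored : Data.Vec.map (punchIn (fs j)) (Data.Vec.map (pinch j) c′) ∷ʳ fs j ≡ c
    c-restored = trans (cong (_∷ʳ fs j) (vec-ext _ c′ λ i →
                   trans (Vec.lookup-map i (punchIn (fs j)) (Data.Vec.map (pinch j) c′)) (trans (cong (punchIn (fs j)) (Vec.lookup-map i (pinch j) c′))
                     (punchIn-pinch j _ (unused i)))))
                 c-split

  add-remove : ∀ p q → add (remove p q) ≡ p
  add-remove (σ , c) q = add-removeColour σ c (∧-true₁ (∧-true₁ q)) (==F-sound _ _ (∧-true₂ {mixed t (σ , c)} (∧-true₁ q)))
    _ (sym (fs-nonSpecial (last c) _))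

  count : countL Q (list (coloureds (suc m) (suc k))) ≡ k * mixedColoured m k t
  count = begin
    countL Q (list (coloureds (suc m) (suc k)))         ≡⟨ bijective-count (coloureds (suc m) (suc k)) (EnumPair (EnumFin k) (coloureds m k))
                                                             Q R remove add Q-add add-remove remove-add ⟩
    countL R (pairs (allFin k) (list (coloureds m k)))  ≡⟨ countL-pairs-snd (mixed t) (allFin k) _ ⟩
    length (allFin k) * countL (mixed t) (list (coloureds m k)) ≡⟨ cong₂ _*_ (List.length-tabulate {n = k} id) (sym (mixedColoured-as-count m k t)) ⟩
    k * mixedColoured m k t                             ∎
    where open ≡-Reasoning

module Inserted (m k t : ℕ) where

  Q : Coloured (suc m) k → Bool
  Q p = mixed t p ∧ not (newFixed p)

  R : Fin m × Coloured m k → Bool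
  R y = mixed t (proj₂ y)

  add : Fin m × Coloured m k → Coloured (suc m) k
  add (s , σ′ , c′) = insertBefore σ′ s , c′ ∷ʳ lookup c′ s

  removeAt : Coloured (suc m) k → Fin m → Fin m × Coloured m k
  removeAt (σ , c) s = s , removeInserted σ , init c

  successor-old : ∀ p → Q p ≡ true → m ≢ toℕ (last (proj₁ p))
  successor-old p q m≡ = true≢false (trans (sym (≡⇒==F (toℕ-injective (trans (sym m≡) (sym (toℕ-fromℕ m))))))
                                           (not≡true⇒false (∧-true₂ {mixed t p} q)))

  remove : ∀ p → Q p ≡ true → Fin m × Coloured m k
  remove p q = removeAt p (lower₁ (last (proj₁ p)) (successor-old p q))

  Q-add : ∀ y → Q (add y) ≡ R y
  Q-add (s , σ′ , c′) = begin
    mixed t (add (s , σ′ , c′)) ∧ not (last (insertBefore σ′ s) ==F fromℕ m)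
      ≡⟨ cong₂ _∧_ (mixed-inserted t σ′ s c′ (lookup c′ s))
                   (cong not (trans (cong (_==F fromℕ m) (last-extend (redirect s) σ′ (inject₁ s))) (==F-false _ _ (old≢new s)))) ⟩
    (mixed t (σ′ , c′) ∧ (lookup c′ s ==F lookup c′ s)) ∧ true
      ≡⟨ cong (λ b → (mixed t (σ′ , c′) ∧ b) ∧ true) (==F-refl (lookup c′ s)) ⟩
    (mixed t (σ′ , c′) ∧ true) ∧ true
      ≡⟨ ∧-true-true _ ⟩
    mixed t (σ′ , c′) ∎
    where open ≡-Reasoning

  remove-add : ∀ y → R y ≡ true → ∀ q → remove (add y) q ≡ y
  remove-add (s , σ′ , c′) _ q =
    trans (cong (removeAt (add (s , σ′ , c′))) (inject₁≡⇒lower₁≡ _ (sym (last-extend (redirect s) σ′ (inject₁ s)))))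
          (cong (s ,_) (cong₂ _,_ (removeInserted-insertBefore σ′ s) (Vec.init-∷ʳ (lookup c′ s) c′)))

  add-removeAt : ∀ σ c → mixed t (σ , c) ≡ true → ∀ s → last σ ≡ inject₁ s → add (removeAt (σ , c) s) ≡ (σ , c)
  add-removeAt σ c mix s last≡s = cong₂ _,_ (insertBefore-removeInserted σ s (∧-true₁ mix) last≡s)
    (trans (cong (init c ∷ʳ_) colour) (init-∷ʳ-last c))
    where
    colour : lookup (init c) s ≡ last c
    colour = begin
      lookup (init c) s                 ≡⟨ lookup-init c s ⟩
      lookup c (inject₁ s)              ≡⟨ cong (lookup c) (trans (sym last≡s) (last≡lookup-new σ)) ⟩
      lookup c (lookup σ (fromℕ m))     ≡⟨ constOnCycles⇒ σ c (∧-true₁ (∧-true₂ {isPerm σ} mix)) (fromℕ m) ⟩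
      lookup c (fromℕ m)                ≡⟨ last≡lookup-new c ⟨
      last c                            ∎
      where open ≡-Reasoning

  add-remove : ∀ p q → add (remove p q) ≡ p
  add-remove (σ , c) q = add-removeAt σ c (∧-true₁ q) _ (sym (inject₁-lower₁ (last σ) (successor-old (σ , c) q)))

  count : countL Q (list (coloureds (suc m) k)) ≡ m * mixedColoured m k t
  count = begin
    countL Q (list (coloureds (suc m) k))               ≡⟨ bijective-count (coloureds (suc m) k) (EnumPair (EnumFin m) (coloureds m k))
                                                             Q R remove add Q-add add-remove remove-add ⟩
    countL R (pairs (allFin m) (list (coloureds m k)))  ≡⟨ countL-pairs-snd (mixed t) (allFin m) _ ⟩
    length (allFin m) * countL (mixed t) (list (coloureds m k)) ≡⟨ cong₂ _*_ (List.length-tabulate {n = m} id) (sym (mixedColoured-as-count m k t)) ⟩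
    m * mixedColoured m k t                             ∎
    where open ≡-Reasoning

mainTheorem9 : (n k t : ℕ) → 1 ≤ n → 1 ≤ k → 1 ≤ t → k ≤ n → t ≤ n →
    mixedColoured n k t
      ≡ mixedColoured (n ∸ 1) k (t ∸ 1)
        + (k ∸ 1) * mixedColoured (n ∸ 1) (k ∸ 1) t
        + (n ∸ 1) * mixedColoured (n ∸ 1) k t
mainTheorem9 (suc m) (suc k) (suc t) _ _ _ _ _ = begin
  mixedColoured (suc m) (suc k) (suc t)
    ≡⟨ mixedColoured-as-count (suc m) (suc k) (suc t) ⟩
  countL (mixed (suc t)) all
    ≡⟨ countL-split (mixed (suc t)) newFixed all ⟩
  countL (λ p → mixed (suc t) p ∧ newFixed p) all + countL (Inserted.Q m (suc k) (suc t)) all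
    ≡⟨ cong (_+ countL (Inserted.Q m (suc k) (suc t)) all) (countL-split _ newSpecial all) ⟩
  countL (FixedSpecial.Q m k t) all + countL (FixedFresh.Q m k (suc t)) all + countL (Inserted.Q m (suc k) (suc t)) all
    ≡⟨ cong₂ _+_ (cong₂ _+_ (FixedSpecial.count m k t) (FixedFresh.count m k (suc t))) (Inserted.count m (suc k) (suc t)) ⟩
  mixedColoured m (suc k) t + k * mixedColoured m k (suc t) + m * mixedColoured m (suc k) (suc t)
    ∎
  where
  open ≡-Reasoning
  all = list (coloureds (suc m) (suc k))
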